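{- Let $\mathcal{G}$ and $\mathcal{H}$ be $d$-uniform hypergraphs, with adjacency matrices $\mathbb{A}_G$ and $\mathbb{A}_H$, such that $\mathcal{G}$ covers $\mathcal{H}$. Then for every perfect coloring of $\mathcal{H}$ with parameter matrix $\mathbb{S}$, there is a perfect coloring of $\mathcal{G}$ with the same parameter matrix $\mathbb{S}$.
   Context: A $d$-uniform hypergraph on vertex set $[n]$ has distinct $d$-element hyperedges. Its adjacency matrix $\mathbb{A}$ is the $d$-dimensional array with $a_{(x_1,\dots,x_d)}=1/(d-1)!$ if $\{x_1,\dots,x_d\}$ is a hyperedge, and $0$ otherwise. A coloring into $k$ colors is a surjective map $f:[n]\to[k]$ with color matrix $P$ ($n\times k$, $p_{x,i}=1$ iff $f(x)=i$). We use $$(\mathbb{A}\circ P)_{x,j_1,\dots,j_{d-1}}=\sum_{x_1,\dots,x_{d-1}}a_{x,x_1,\dots,x_{d-1}}p_{x_1,j_1}\cdots p_{x_{d-1},j_{d-1}},\qquad (P\circ\mathbb{S})_{x,\beta}=\sum_ip_{x,i}s_{i,\beta}.$$ The coloring is perfect if there is a $d$-dimensional $\mathbb{S}$ of order $k$ with $\mathbb{A}\circ P=P\circ\mathbb{S}$ (equivalently, all vertices of the same color lie in equally many hyperedges of each color range, the color range of $e$ being the multiset $\{f(x):x\in e\}$); $\mathbb{S}$ is the parameter matrix. $\mathcal{G}$ covers $\mathcal{H}$ if there is a surjective map $\varphi:X(\mathcal{G})\to X(\mathcal{H})$ with the following properties: - for each hyperedge $e$ of $\mathcal{G}$, $\varphi$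 is injective on $e$ and $\varphi(e)$ is a hyperedge of $\mathcal{H}$; - for each vertex $x$, $e\mapsto\varphi(e)$ is a bijection from hyperedges containing $x$ onto hyperedges containing $\varphi(x)$. -}

module Defs where

open import Data.Nat as ℕ using (ℕ; zero; suc; _!)
open import Data.Nat.Properties using (_!≢0)
open import Data.Fin as Fin using (Fin)
open import Data.Fin.Subset using (Subset; ⁅_⁆; ⋃; ∣_∣; _∈_; ⊤)
open import Data.Fin.Subset.Properties using (_∈?_)
open import Data.Fin.Properties using () renaming (_≟_ to _≟ᶠ_)
open import Data.Bool using (Bool)
open import Data.Bool.Properties using () renaming (_≟_ to _≟ᵇ_)
open import Data.Vec.Properties using (≡-dec)
open import Data.Vec.Functional using (_∷_)
open import Data.List as List using (List; allFin; filter)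
open import Data.List.Relation.Unary.All using (All)
open import Data.List.Relation.Unary.Any using (any?)
open import Data.List.Relation.Unary.Unique.Propositional using (Unique)
open import Data.List.Membership.Propositional using () renaming (_∈_ to _∈ₗ_)
open import Data.Rational using (ℚ; 0ℚ; 1ℚ; _+_; _*_; _/_)
open import Data.Integer using (+_)
open import Data.Product using (Σ; _×_; ∃; _,_; proj₁)
open import Function using (Surjective)
open import Relation.Binary.PropositionalEquality using (_≡_)
open import Relation.Nullary using (yes; no; Dec)
open import Relation.Nullary.Decidable using (⌊_⌋)

sumFin : (n : ℕ) → (Fin n → ℚ) → ℚ
sumFin zero    g = 0ℚ
sumFin (suc n) g = g Fin.zero + sumFin n (λ i → g (Fin.suc i))

prodFin : (n : ℕ) → (Fin n → ℚ) → ℚ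
prodFin zero    g = 1ℚ
prodFin (suc n) g = g Fin.zero * prodFin n (λ i → g (Fin.suc i))

sumTuples : (m n : ℕ) → ((Fin m → Fin n) → ℚ) → ℚ
sumTuples zero    n g = g (λ ())
sumTuples (suc m) n g = sumFin n (λ i → sumTuples m n (λ t → g (i ∷ t)))

_≟ₛ_ : {n : ℕ} → (a b : Subset n) → Dec (a ≡ b)
_≟ₛ_ = ≡-dec _≟ᵇ_

image : {n n' : ℕ} → (Fin n → Fin n') → Subset n → Subset n'
image {n} φ e = ⋃ (List.map (λ x → ⁅ φ x ⁆) (filter (_∈? e) (allFin n)))

record Hypergraph (d : ℕ) : Set where
  field
    n        : ℕ
    edges    : List (Subset n)
    uniform  : All (λ e → ∣ e ∣ ≡ d) edges
    distinct : Unique edges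
open Hypergraph public

isEdge? : {d : ℕ} (G : Hypergraph d) (e : Subset (n G)) → Dec (e ∈ₗ edges G)
isEdge? G e = any? (e ≟ₛ_) (edges G)

-- Adjacency array of a (suc m)-uniform hypergraph (d = suc m, d - 1 = m):
-- entry at (x_1,...,x_d) is 1/(d-1)! if {x_1,...,x_d} is a hyperedge, else 0.
adj : {m : ℕ} (G : Hypergraph (suc m)) → (Fin (suc m) → Fin (n G)) → ℚ
adj {m} G t with isEdge? G (image t ⊤)
... | yes _ = (+ 1 / (m !)) {{m !≢0}}
... | no  _ = 0ℚ

Coloring : ℕ → ℕ → Set
Coloring n k = Σ (Fin n → Fin k) (λ f → Surjective _≡_ _≡_ f)

colorMatrix : {n k : ℕ} → (Fin n → Fin k) → Fin n → Fin k → ℚ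
colorMatrix f x i with f x ≟ᶠ i
... | yes _ = 1ℚ
... | no  _ = 0ℚ

AcircP : {m : ℕ} (G : Hypergraph (suc m)) {k : ℕ} → (Fin (n G) → Fin k)
       → Fin (n G) → (Fin m → Fin k) → ℚ
AcircP {m} G f x j =
  sumTuples m (n G) (λ t → adj G (x ∷ t) * prodFin m (λ l → colorMatrix f (t l) (j l)))

-- parameter-matrix shape: d-dimensional array of order k, indices (i, β)
ParamMatrix : ℕ → ℕ → Set
ParamMatrix m k = Fin k → (Fin m → Fin k) → ℚ

PcircS : {m n k : ℕ} → (Fin n → Fin k) → ParamMatrix m k → Fin n → (Fin m → Fin k) → ℚ
PcircS {k = k} f S x β = sumFin k (λ i → colorMatrix f x i * S i β)

IsParameterMatrix : {m : ℕ} (G : Hypergraph (suc m)) {k : ℕ}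
                  → Coloring (n G) k → ParamMatrix m k → Set
IsParameterMatrix G c S = ∀ x β → AcircP G (proj₁ c) x β ≡ PcircS (proj₁ c) S x β

IsPerfectWith : {m : ℕ} (G : Hypergraph (suc m)) {k : ℕ}
              → Coloring (n G) k → ParamMatrix m k → Set
IsPerfectWith = IsParameterMatrix

Covers : {d : ℕ} → Hypergraph d → Hypergraph d → Set
Covers G H = Σ (Fin (n G) → Fin (n H)) λ φ →
    Surjective _≡_ _≡_ φ
  × (∀ e → e ∈ₗ edges G →
        (∀ x y → x ∈ e → y ∈ e → φ x ≡ φ y → x ≡ y)
      × (image φ e ∈ₗ edges H))
  × (∀ x →
        (∀ e e' → e ∈ₗ edges G → x ∈ e → e' ∈ₗ edges G → x ∈ e'
           → image φ e ≡ image φ e' → e ≡ e')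
      × (∀ e' → e' ∈ₗ edges H → φ x ∈ e'
           → ∃ λ e → e ∈ₗ edges G × x ∈ e × image φ e ≡ e'))

module Submission where

-- A covering φ : G → H maps the hyperedges through x bijectively onto the
-- hyperedges through φ x, injectively on each hyperedge.  Hence every tuple
-- (φ x , u) spanning a hyperedge of H lifts to exactly one tuple (x , t) with
-- φ ∘ t = u spanning a hyperedge of G, and the tuples (x , t) spanning no
-- hyperedge contribute nothing.  Grouping the sum defining (A_G ∘ P')_x by the
-- fibres of t ↦ φ ∘ t therefore gives (A_G ∘ P')_x = (A_H ∘ P)_{φ x} for the
-- pulled-back coloring f ∘ φ, so A_H ∘ P = P ∘ S pulls back to G.

open import Defs
open import Data.Nat using (ℕ; zero; suc; _!)
open import Data.Nat.Properties using (_!≢0)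
import Data.Integer as ℤ
open import Data.Fin using (Fin)
open import Data.Fin.Properties using (suc-injective) renaming (_≟_ to _≟ᶠ_)
open import Data.Fin.Subset using (Subset; ⁅_⁆; ⋃; _∈_; ⊤)
open import Data.Fin.Subset.Properties
  using (_∈?_; x∈p∪q⁻; x∈p∪q⁺; ∉⊥; ∈⊤; x∈⁅x⁆; x∈⁅y⁆⇒x≡y; ⊆-antisym)
open import Data.Vec.Functional using (_∷_)
open import Data.Vec.Functional.Properties using (∷-cong; ≗-dec)
open import Data.List as List using (List; []; allFin)
open import Data.List.Relation.Unary.Any using (here; there)
open import Data.List.Membership.Propositional using () renaming (_∈_ to _∈ₗ_)
open import Data.List.Membership.Propositional.Properties
  using (∈-map⁺; ∈-map⁻; ∈-filter⁺; ∈-filter⁻; ∈-allFin)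
open import Data.Rational using (ℚ; 0ℚ; 1ℚ; _+_; _*_; _/_)
open import Data.Rational.Properties
  using (+-identityˡ; +-identityʳ; *-identityˡ; *-zeroˡ; *-zeroʳ; *-distribʳ-+;
         +-0-commutativeMonoid)
open import Algebra.Bundles using (CommutativeMonoid)
open import Algebra.Properties.CommutativeSemigroup
  (CommutativeMonoid.commutativeSemigroup +-0-commutativeMonoid) using (interchange)
open import Data.Product using (Σ; ∃; _×_; _,_; proj₁; proj₂)
open import Data.Sum using (inj₁; inj₂; [_,_]′)
open import Data.Empty using (⊥; ⊥-elim)
open import Function using (_∘_; Surjective)
open import Function.Construct.Composition using (surjective)
open import Relation.Binary.Core using (_Preserves_⟶_)
open import Relation.Binary.PropositionalEquality
open import Relation.Nullary using (yes; no; Dec; ¬_)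
open import Relation.Nullary.Decidable using (toSum)

sumFin-cong : ∀ n {f g : Fin n → ℚ} → f ≗ g → sumFin n f ≡ sumFin n g
sumFin-cong zero    f≗g = refl
sumFin-cong (suc n) f≗g = cong₂ _+_ (f≗g Fin.zero) (sumFin-cong n (f≗g ∘ Fin.suc))

sumFin-zero : ∀ n {f : Fin n → ℚ} → (∀ i → f i ≡ 0ℚ) → sumFin n f ≡ 0ℚ
sumFin-zero zero    f≡0 = refl
sumFin-zero (suc n) f≡0 =
  trans (cong₂ _+_ (f≡0 Fin.zero) (sumFin-zero n (f≡0 ∘ Fin.suc))) (+-identityˡ 0ℚ)

sumFin-+ : ∀ n (f g : Fin n → ℚ) → sumFin n (λ i → f i + g i) ≡ sumFin n f + sumFin n g
sumFin-+ zero    f g = sym (+-identityˡ 0ℚ)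
sumFin-+ (suc n) f g =
  trans (cong ((f Fin.zero + g Fin.zero) +_) (sumFin-+ n (f ∘ Fin.suc) (g ∘ Fin.suc)))
        (interchange (f Fin.zero) (g Fin.zero) (sumFin n (f ∘ Fin.suc)) (sumFin n (g ∘ Fin.suc)))

sumFin-swap : ∀ a b (F : Fin a → Fin b → ℚ) →
  sumFin a (λ i → sumFin b (F i)) ≡ sumFin b (λ j → sumFin a (λ i → F i j))
sumFin-swap zero    b F = sym (sumFin-zero b (λ _ → refl))
sumFin-swap (suc a) b F =
  trans (cong (sumFin b (F Fin.zero) +_) (sumFin-swap a b (F ∘ Fin.suc))) (sym (sumFin-+ b _ _))

sumFin-*ʳ : ∀ n (f : Fin n → ℚ) c → sumFin n (λ i → f i * c) ≡ sumFin n f * c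
sumFin-*ʳ zero    f c = sym (*-zeroˡ c)
sumFin-*ʳ (suc n) f c =
  trans (cong (f Fin.zero * c +_) (sumFin-*ʳ n (f ∘ Fin.suc) c))
        (sym (*-distribʳ-+ c (f Fin.zero) (sumFin n (f ∘ Fin.suc))))

sumFin-single : ∀ n (f : Fin n → ℚ) i₀ {c} → f i₀ ≡ c → (∀ i → i ≢ i₀ → f i ≡ 0ℚ) →
  sumFin n f ≡ c
sumFin-single (suc n) f Fin.zero    {c} fi₀≡c f≡0 =
  trans (cong₂ _+_ fi₀≡c (sumFin-zero n (λ i → f≡0 (Fin.suc i) (λ ())))) (+-identityʳ c)
sumFin-single (suc n) f (Fin.suc i₀) {c} fi₀≡c f≡0 =
  trans (cong₂ _+_ (f≡0 Fin.zero (λ ()))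
                   (sumFin-single n (f ∘ Fin.suc) i₀ fi₀≡c (λ i i≢i₀ → f≡0 (Fin.suc i) (i≢i₀ ∘ suc-injective))))
        (+-identityˡ c)

sumTuples-cong : ∀ m n {f g : (Fin m → Fin n) → ℚ} → (∀ t → f t ≡ g t) →
  sumTuples m n f ≡ sumTuples m n g
sumTuples-cong zero    n f≡g = f≡g _
sumTuples-cong (suc m) n f≡g = sumFin-cong n (λ i → sumTuples-cong m n (λ t → f≡g (i ∷ t)))

sumTuples-zero : ∀ m n {f : (Fin m → Fin n) → ℚ} → (∀ t → f t ≡ 0ℚ) → sumTuples m n f ≡ 0ℚ
sumTuples-zero zero    n f≡0 = f≡0 _
sumTuples-zero (suc m) n f≡0 = sumFin-zero n (λ i → sumTuples-zero m n (λ t → f≡0 (i ∷ t)))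

sumTuples-*ʳ : ∀ m n (f : (Fin m → Fin n) → ℚ) c →
  sumTuples m n (λ t → f t * c) ≡ sumTuples m n f * c
sumTuples-*ʳ zero    n f c = refl
sumTuples-*ʳ (suc m) n f c = trans (sumFin-cong n (λ i → sumTuples-*ʳ m n _ c)) (sumFin-*ʳ n _ c)

sumFin-sumTuples-swap : ∀ m a b (F : Fin b → (Fin m → Fin a) → ℚ) →
  sumFin b (λ j → sumTuples m a (F j)) ≡ sumTuples m a (λ t → sumFin b (λ j → F j t))
sumFin-sumTuples-swap zero    a b F = refl
sumFin-sumTuples-swap (suc m) a b F =
  trans (sumFin-swap b a _) (sumFin-cong a (λ i → sumFin-sumTuples-swap m a b (λ j t → F j (i ∷ t))))

sumTuples-swap : ∀ m m′ a b (F : (Fin m′ → Fin b) → (Fin m → Fin a) → ℚ) →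
  sumTuples m′ b (λ u → sumTuples m a (F u)) ≡ sumTuples m a (λ t → sumTuples m′ b (λ u → F u t))
sumTuples-swap m zero     a b F = refl
sumTuples-swap m (suc m′) a b F =
  trans (sumFin-cong b (λ j → sumTuples-swap m m′ a b (λ u → F (j ∷ u))))
        (sumFin-sumTuples-swap m a b (λ j t → sumTuples m′ b (λ u → F (j ∷ u) t)))

sumTuples-single : ∀ m n (f : (Fin m → Fin n) → ℚ) t₀ {c} →
  (∀ t → t ≗ t₀ → f t ≡ c) → (∀ t → ¬ t ≗ t₀ → f t ≡ 0ℚ) → sumTuples m n f ≡ c
sumTuples-single zero    n f t₀ f≡c f≡0 = f≡c _ (λ ())
sumTuples-single (suc m) n f t₀ f≡c f≡0 =
  sumFin-single n _ (t₀ Fin.zero)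
    (sumTuples-single m n _ (t₀ ∘ Fin.suc)
       (λ t t≗ → f≡c (t₀ Fin.zero ∷ t) (∷-cong refl t≗))
       (λ t t≉ → f≡0 _ (λ t≗ → t≉ (t≗ ∘ Fin.suc))))
    (λ i i≢ → sumTuples-zero m n (λ t → f≡0 _ (λ t≗ → i≢ (t≗ Fin.zero))))

δ : ∀ {m n} → (Fin m → Fin n) → (Fin m → Fin n) → ℚ
δ u v with ≗-dec _≟ᶠ_ u v
... | yes _ = 1ℚ
... | no  _ = 0ℚ

δ-≗ : ∀ {m n} {u v : Fin m → Fin n} → u ≗ v → δ u v ≡ 1ℚ
δ-≗ {u = u} {v} u≗v with ≗-dec _≟ᶠ_ u v
... | yes _   = refl
... | no  u≉v = ⊥-elim (u≉v u≗v)

δ-≉ : ∀ {m n} {u v : Fin m → Fin n} → ¬ u ≗ v → δ u v ≡ 0ℚ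
δ-≉ {u = u} {v} u≉v with ≗-dec _≟ᶠ_ u v
... | yes u≗v = ⊥-elim (u≉v u≗v)
... | no  _   = refl

sumTuples-δ : ∀ m n (u : Fin m → Fin n) → sumTuples m n (δ u) ≡ 1ℚ
sumTuples-δ m n u = sumTuples-single m n (δ u) u (λ v v≗u → δ-≗ (sym ∘ v≗u))
                                                 (λ v v≉u → δ-≉ (λ u≗v → v≉u (sym ∘ u≗v)))

sumTuples-fibres : ∀ m a b (ψ : Fin a → Fin b) (g : (Fin m → Fin a) → ℚ) →
  sumTuples m a g ≡ sumTuples m b (λ u → sumTuples m a (λ t → δ (ψ ∘ t) u * g t))
sumTuples-fibres m a b ψ g = begin
  sumTuples m a g
    ≡⟨ sumTuples-cong m a (λ t → sym (trans (cong (_* g t) (sumTuples-δ m b (ψ ∘ t))) (*-identityˡ (g t)))) ⟩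
  sumTuples m a (λ t → sumTuples m b (δ (ψ ∘ t)) * g t)
    ≡⟨ sumTuples-cong m a (λ t → sym (sumTuples-*ʳ m b (δ (ψ ∘ t)) (g t))) ⟩
  sumTuples m a (λ t → sumTuples m b (λ u → δ (ψ ∘ t) u * g t))
    ≡⟨ sym (sumTuples-swap m m a b (λ u t → δ (ψ ∘ t) u * g t)) ⟩
  sumTuples m b (λ u → sumTuples m a (λ t → δ (ψ ∘ t) u * g t)) ∎
  where open ≡-Reasoning

x∈⋃⁻ : ∀ {n} {x : Fin n} (ps : List (Subset n)) → x ∈ ⋃ ps → ∃ λ p → p ∈ₗ ps × x ∈ p
x∈⋃⁻ []       x∈⋃ = ⊥-elim (∉⊥ x∈⋃)
x∈⋃⁻ (p List.∷ ps) x∈⋃ with x∈p∪q⁻ p (⋃ ps) x∈⋃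
... | inj₁ x∈p  = p , here refl , x∈p
... | inj₂ x∈⋃′ with x∈⋃⁻ ps x∈⋃′
...   | q , q∈ps , x∈q = q , there q∈ps , x∈q

x∈⋃⁺ : ∀ {n} {x : Fin n} {p} (ps : List (Subset n)) → p ∈ₗ ps → x ∈ p → x ∈ ⋃ ps
x∈⋃⁺ (p List.∷ ps) (here refl)  x∈p = x∈p∪q⁺ (inj₁ x∈p)
x∈⋃⁺ (p List.∷ ps) (there p∈ps) x∈p = x∈p∪q⁺ {p = p} (inj₂ (x∈⋃⁺ ps p∈ps x∈p))

∈-image⁻ : ∀ {n n′} (φ : Fin n → Fin n′) e {y} → y ∈ image φ e → ∃ λ x → x ∈ e × φ x ≡ y
∈-image⁻ {n} φ e y∈ with x∈⋃⁻ _ y∈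
... | s , s∈ , y∈s with ∈-map⁻ (λ x → ⁅ φ x ⁆) s∈
...   | x , x∈ , refl = x , proj₂ (∈-filter⁻ (_∈? e) {xs = allFin n} x∈) , sym (x∈⁅y⁆⇒x≡y _ y∈s)

∈-image⁺ : ∀ {n n′} (φ : Fin n → Fin n′) e {x} → x ∈ e → φ x ∈ image φ e
∈-image⁺ φ e {x} x∈e =
  x∈⋃⁺ _ (∈-map⁺ (λ x → ⁅ φ x ⁆) (∈-filter⁺ (_∈? e) (∈-allFin x) x∈e)) (x∈⁅x⁆ (φ x))

image-cong : ∀ {n n′} {φ ψ : Fin n → Fin n′} → φ ≗ ψ → ∀ e → image φ e ≡ image ψ e
image-cong {φ = φ} {ψ} φ≗ψ e = ⊆-antisym (into φ≗ψ) (into (sym ∘ φ≗ψ))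
  where
  into : ∀ {φ ψ : _ → _} → φ ≗ ψ → ∀ {y} → y ∈ image φ e → y ∈ image ψ e
  into {φ} {ψ} φ≗ψ y∈ with ∈-image⁻ φ e y∈
  ... | x , x∈e , refl = subst (_∈ image ψ e) (sym (φ≗ψ x)) (∈-image⁺ ψ e x∈e)

image-∘ : ∀ {n n′ n″} (ψ : Fin n′ → Fin n″) (φ : Fin n → Fin n′) e →
  image ψ (image φ e) ≡ image (ψ ∘ φ) e
image-∘ ψ φ e = ⊆-antisym into onto
  where
  into : ∀ {z} → z ∈ image ψ (image φ e) → z ∈ image (ψ ∘ φ) e
  into z∈ with ∈-image⁻ ψ _ z∈
  ... | y , y∈ , refl with ∈-image⁻ φ e y∈
  ...   | x , x∈e , refl = ∈-image⁺ (ψ ∘ φ) e x∈e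
  onto : ∀ {z} → z ∈ image (ψ ∘ φ) e → z ∈ image ψ (image φ e)
  onto z∈ with ∈-image⁻ (ψ ∘ φ) e z∈
  ... | x , x∈e , refl = ∈-image⁺ ψ _ (∈-image⁺ φ e x∈e)

range : ∀ {m n} → (Fin m → Fin n) → Subset n
range t = image t ⊤

∈-range⁺ : ∀ {m n} (t : Fin m → Fin n) l → t l ∈ range t
∈-range⁺ t l = ∈-image⁺ t ⊤ ∈⊤

∈-range⁻ : ∀ {m n} (t : Fin m → Fin n) {y} → y ∈ range t → ∃ λ l → t l ≡ y
∈-range⁻ t y∈ with ∈-image⁻ t ⊤ y∈
... | l , _ , tl≡y = l , tl≡y

adj-edge : ∀ {m} (G : Hypergraph (suc m)) t → range t ∈ₗ edges G →
  adj G t ≡ (ℤ.+ 1 / (m !)) {{m !≢0}}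
adj-edge G t t∈G with isEdge? G (range t)
... | yes _   = refl
... | no  t∉G = ⊥-elim (t∉G t∈G)

adj-nonedge : ∀ {m} (G : Hypergraph (suc m)) t → ¬ range t ∈ₗ edges G → adj G t ≡ 0ℚ
adj-nonedge G t t∉G with isEdge? G (range t)
... | yes t∈G = ⊥-elim (t∉G t∈G)
... | no  _   = refl

colorMatrix-∘ : ∀ {n n′ k} (f : Fin n′ → Fin k) (φ : Fin n → Fin n′) x i →
  colorMatrix (f ∘ φ) x i ≡ colorMatrix f (φ x) i
colorMatrix-∘ f φ x i with f (φ x) ≟ᶠ i
... | yes _ = refl
... | no  _ = refl

prodFin-cong : ∀ n {f g : Fin n → ℚ} → f ≗ g → prodFin n f ≡ prodFin n g
prodFin-cong zero    f≗g = refl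
prodFin-cong (suc n) f≗g = cong₂ _*_ (f≗g Fin.zero) (prodFin-cong n (f≗g ∘ Fin.suc))

module Covering {m} {G H : Hypergraph (suc m)} (cov : Covers G H) where

  φ : Fin (n G) → Fin (n H)
  φ = proj₁ cov

  φ-surjective : Surjective _≡_ _≡_ φ
  φ-surjective = proj₁ (proj₂ cov)

  injective-on-edge : ∀ {e} → e ∈ₗ edges G → ∀ {x y} → x ∈ e → y ∈ e → φ x ≡ φ y → x ≡ y
  injective-on-edge e∈G = proj₁ (proj₁ (proj₂ (proj₂ cov)) _ e∈G) _ _

  image-edge : ∀ {e} → e ∈ₗ edges G → image φ e ∈ₗ edges H
  image-edge e∈G = proj₂ (proj₁ (proj₂ (proj₂ cov)) _ e∈G)

  injective-on-star : ∀ x {e e′} → e ∈ₗ edges G → x ∈ e → e′ ∈ₗ edges G → x ∈ e′ →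
    image φ e ≡ image φ e′ → e ≡ e′
  injective-on-star x = proj₁ (proj₂ (proj₂ (proj₂ cov)) x) _ _

  surjective-on-star : ∀ x {e′} → e′ ∈ₗ edges H → φ x ∈ e′ →
    ∃ λ e → e ∈ₗ edges G × x ∈ e × image φ e ≡ e′
  surjective-on-star x = proj₂ (proj₂ (proj₂ (proj₂ cov)) x) _

  -- The tuples are explicit arguments below: recovering t from `range (x ∷ t)`
  -- by unification makes Agda normalise `image`, which is prohibitively slow.
  module _ (x : Fin (n G)) where

    image-range : ∀ (t : Fin m → Fin (n G)) u → φ ∘ t ≗ u → image φ (range (x ∷ t)) ≡ range (φ x ∷ u)
    image-range t u φt≗u =
      trans (image-∘ φ (x ∷ t) ⊤) (image-cong {φ = φ ∘ (x ∷ t)} {ψ = φ x ∷ u} (∷-cong refl φt≗u) ⊤)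

    edge-projects : ∀ t u → range (x ∷ t) ∈ₗ edges G → φ ∘ t ≗ u → range (φ x ∷ u) ∈ₗ edges H
    edge-projects t u t∈G φt≗u = subst (_∈ₗ edges H) (image-range t u φt≗u) (image-edge t∈G)

    edge-lifts : ∀ u → range (φ x ∷ u) ∈ₗ edges H →
      ∃ λ t → φ ∘ t ≗ u × range (x ∷ t) ∈ₗ edges G
    edge-lifts u u∈H with surjective-on-star x u∈H (∈-range⁺ (φ x ∷ u) Fin.zero)
    ... | e , e∈G , x∈e , φe≡u = t , φt≗u , subst (_∈ₗ edges G) (sym range≡e) e∈G
      where
      preimage : ∀ l → ∃ λ y → y ∈ e × φ y ≡ u l
      preimage l = ∈-image⁻ φ e (subst (u l ∈_) (sym φe≡u) (∈-range⁺ (φ x ∷ u) (Fin.suc l)))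
      t : Fin m → Fin (n G)
      t = proj₁ ∘ preimage
      t∈e : ∀ l → t l ∈ e
      t∈e = proj₁ ∘ proj₂ ∘ preimage
      φt≗u : φ ∘ t ≗ u
      φt≗u = proj₂ ∘ proj₂ ∘ preimage
      range⊆e : ∀ {y} → y ∈ range (x ∷ t) → y ∈ e
      range⊆e y∈ with ∈-range⁻ (x ∷ t) y∈
      ... | Fin.zero  , refl = x∈e
      ... | Fin.suc l , refl = t∈e l
      -- y and the chosen point of range (x ∷ t) over φ y are both in e, where φ is injective
      e⊆range : ∀ {y} → y ∈ e → y ∈ range (x ∷ t)
      e⊆range {y} y∈e with ∈-range⁻ (φ x ∷ u) (subst (φ y ∈_) φe≡u (∈-image⁺ φ e y∈e))
      ... | l , φxu≡φy = subst (_∈ range (x ∷ t))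
              (injective-on-edge e∈G (range⊆e (∈-range⁺ (x ∷ t) l)) y∈e
                 (trans (∷-cong {xs = φ ∘ (x ∷ t)} {ys = φ x ∷ u} refl φt≗u l) φxu≡φy))
              (∈-range⁺ (x ∷ t) l)
      range≡e : range (x ∷ t) ≡ e
      range≡e = ⊆-antisym range⊆e e⊆range

    edge-lift-unique : ∀ t t′ → range (x ∷ t) ∈ₗ edges G → range (x ∷ t′) ∈ₗ edges G →
      φ ∘ t ≗ φ ∘ t′ → t ≗ t′
    edge-lift-unique t t′ t∈G t′∈G φt≗φt′ l =
      injective-on-edge t′∈G (subst (t l ∈_) same-edge (∈-range⁺ (x ∷ t) (Fin.suc l)))
                             (∈-range⁺ (x ∷ t′) (Fin.suc l)) (φt≗φt′ l)
      where
      same-edge : range (x ∷ t) ≡ range (x ∷ t′)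
      same-edge = injective-on-star x t∈G (∈-range⁺ (x ∷ t) Fin.zero) t′∈G (∈-range⁺ (x ∷ t′) Fin.zero)
                    (trans (image-range t (φ ∘ t′) φt≗φt′) (sym (image-range t′ (φ ∘ t′) (λ _ → refl))))

    module _ (w : (Fin m → Fin (n H)) → ℚ) (w-cong : w Preserves _≗_ ⟶ _≡_) where

      fibre-term : (Fin m → Fin (n H)) → (Fin m → Fin (n G)) → ℚ
      fibre-term u t = δ (φ ∘ t) u * (adj G (x ∷ t) * w (φ ∘ t))

      fibre-term-zero : ∀ u t → (φ ∘ t ≗ u → range (x ∷ t) ∈ₗ edges G → ⊥) → fibre-term u t ≡ 0ℚ
      fibre-term-zero u t not-lift = cases (≗-dec _≟ᶠ_ (φ ∘ t) u) (isEdge? G (range (x ∷ t)))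
        where
        open ≡-Reasoning
        cases : Dec (φ ∘ t ≗ u) → Dec (range (x ∷ t) ∈ₗ edges G) → fibre-term u t ≡ 0ℚ
        cases (no φt≉u) _ = begin
          δ (φ ∘ t) u * (adj G (x ∷ t) * w (φ ∘ t)) ≡⟨ cong (_* (adj G (x ∷ t) * w (φ ∘ t))) (δ-≉ φt≉u) ⟩
          0ℚ * (adj G (x ∷ t) * w (φ ∘ t))          ≡⟨ *-zeroˡ (adj G (x ∷ t) * w (φ ∘ t)) ⟩
          0ℚ                                        ∎
        cases (yes _) (no t∉G) = begin
          δ (φ ∘ t) u * (adj G (x ∷ t) * w (φ ∘ t)) ≡⟨ cong (λ a → δ (φ ∘ t) u * (a * w (φ ∘ t)))
                                                             (adj-nonedge G (x ∷ t) t∉G) ⟩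
          δ (φ ∘ t) u * (0ℚ * w (φ ∘ t))            ≡⟨ cong (δ (φ ∘ t) u *_) (*-zeroˡ (w (φ ∘ t))) ⟩
          δ (φ ∘ t) u * 0ℚ                          ≡⟨ *-zeroʳ (δ (φ ∘ t) u) ⟩
          0ℚ                                        ∎
        cases (yes φt≗u) (yes t∈G) = ⊥-elim (not-lift φt≗u t∈G)

      fibre-sum-nonedge : ∀ u → ¬ range (φ x ∷ u) ∈ₗ edges H →
        sumTuples m (n G) (fibre-term u) ≡ adj H (φ x ∷ u) * w u
      fibre-sum-nonedge u u∉H = begin
        sumTuples m (n G) (fibre-term u) ≡⟨ sumTuples-zero m (n G) (λ t → fibre-term-zero u t
                                               (λ φt≗u t∈G → u∉H (edge-projects t u t∈G φt≗u))) ⟩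
        0ℚ                               ≡⟨ sym (*-zeroˡ (w u)) ⟩
        0ℚ * w u                         ≡⟨ cong (_* w u) (sym (adj-nonedge H (φ x ∷ u) u∉H)) ⟩
        adj H (φ x ∷ u) * w u            ∎
        where open ≡-Reasoning

      fibre-sum-over-lift : ∀ u t₀ → φ ∘ t₀ ≗ u → range (x ∷ t₀) ∈ₗ edges G →
        sumTuples m (n G) (fibre-term u) ≡ adj H (φ x ∷ u) * w u
      fibre-sum-over-lift u t₀ φt₀≗u t₀∈G = sumTuples-single m (n G) (fibre-term u) t₀ on-lift off-lift
        where
        u∈H : range (φ x ∷ u) ∈ₗ edges H
        u∈H = edge-projects t₀ u t₀∈G φt₀≗u
        on-lift : ∀ t → t ≗ t₀ → fibre-term u t ≡ adj H (φ x ∷ u) * w u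
        on-lift t t≗t₀ = begin
          δ (φ ∘ t) u * (adj G (x ∷ t) * w (φ ∘ t)) ≡⟨ cong (_* (adj G (x ∷ t) * w (φ ∘ t))) (δ-≗ φt≗u) ⟩
          1ℚ * (adj G (x ∷ t) * w (φ ∘ t))          ≡⟨ *-identityˡ (adj G (x ∷ t) * w (φ ∘ t)) ⟩
          adj G (x ∷ t) * w (φ ∘ t)                 ≡⟨ cong₂ _*_ (trans (adj-edge G (x ∷ t) t∈G)
                                                                   (sym (adj-edge H (φ x ∷ u) u∈H)))
                                                                 (w-cong φt≗u) ⟩
          adj H (φ x ∷ u) * w u                     ∎
          where
          open ≡-Reasoning
          φt≗u : φ ∘ t ≗ u
          φt≗u l = trans (cong φ (t≗t₀ l)) (φt₀≗u l)
          t∈G : range (x ∷ t) ∈ₗ edges G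
          t∈G = subst (_∈ₗ edges G)
                  (image-cong {φ = x ∷ t₀} {ψ = x ∷ t} (∷-cong refl (sym ∘ t≗t₀)) ⊤) t₀∈G
        off-lift : ∀ t → ¬ t ≗ t₀ → fibre-term u t ≡ 0ℚ
        off-lift t t≉t₀ = fibre-term-zero u t λ φt≗u t∈G →
          t≉t₀ (edge-lift-unique t t₀ t∈G t₀∈G (λ l → trans (φt≗u l) (sym (φt₀≗u l))))

      fibre-sum-edge : ∀ u → range (φ x ∷ u) ∈ₗ edges H →
        sumTuples m (n G) (fibre-term u) ≡ adj H (φ x ∷ u) * w u
      fibre-sum-edge u u∈H = let t₀ , φt₀≗u , t₀∈G = edge-lifts u u∈H in
        fibre-sum-over-lift u t₀ φt₀≗u t₀∈G

      fibre-sum : ∀ u → sumTuples m (n G) (fibre-term u) ≡ adj H (φ x ∷ u) * w u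
      fibre-sum u = [ fibre-sum-edge u , fibre-sum-nonedge u ]′ (toSum (isEdge? H (range (φ x ∷ u))))

      adjacency-sum-lift : sumTuples m (n G) (λ t → adj G (x ∷ t) * w (φ ∘ t))
                         ≡ sumTuples m (n H) (λ u → adj H (φ x ∷ u) * w u)
      adjacency-sum-lift =
        trans (sumTuples-fibres m (n G) (n H) φ _) (sumTuples-cong m (n H) fibre-sum)

  AcircP-∘ : ∀ {k} (f : Fin (n H) → Fin k) x j → AcircP G (f ∘ φ) x j ≡ AcircP H f (φ x) j
  AcircP-∘ f x j =
    trans (sumTuples-cong m (n G) (λ t → cong (adj G (x ∷ t) *_)
                                    (prodFin-cong m (λ l → colorMatrix-∘ f φ (t l) (j l)))))
          (adjacency-sum-lift x colors colors-cong)
    where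
    colors : (Fin m → Fin (n H)) → ℚ
    colors u = prodFin m (λ l → colorMatrix f (u l) (j l))
    colors-cong : colors Preserves _≗_ ⟶ _≡_
    colors-cong u≗v = prodFin-cong m (λ l → cong (λ y → colorMatrix f y (j l)) (u≗v l))

  PcircS-∘ : ∀ {k} (f : Fin (n H) → Fin k) (S : ParamMatrix m k) x β →
    PcircS f S (φ x) β ≡ PcircS (f ∘ φ) S x β
  PcircS-∘ {k} f S x β = sumFin-cong k (λ i → cong (_* S i β) (sym (colorMatrix-∘ f φ x i)))

theorem11 : (m : ℕ) (G H : Hypergraph (suc m)) → Covers G H
    → (k : ℕ) (c : Coloring (n H) k) (S : ParamMatrix m k)
    → IsPerfectWith H c S
    → Σ (Coloring (n G) k) (λ c' → IsPerfectWith G c' S)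
theorem11 m G H cov k (f , f-surjective) S perfect =
  (f ∘ φ , surjective _≡_ _≡_ _≡_ φ-surjective f-surjective) , λ x β → begin
    AcircP G (f ∘ φ) x β ≡⟨ AcircP-∘ f x β ⟩
    AcircP H f (φ x) β   ≡⟨ perfect (φ x) β ⟩
    PcircS f S (φ x) β   ≡⟨ PcircS-∘ f S x β ⟩
    PcircS (f ∘ φ) S x β ∎
  where
  open Covering cov
  open ≡-Reasoning
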